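{- On the class of all finite structures, $\mathrm{NPSB}(1)\subsetneq\mathrm{NPSB}(2)\subsetneq\mathrm{NPSB}(3)$ (as classes of problems).
   Context: All structures are finite with at least two elements; problems are isomorphism-closed classes of finite structures; no built-in order is present. Program schemes of $\mathrm{NPSA}(1)$ over $\sigma$: variables $x_1,\dots,x_k$, array symbols; instructions $\mathtt{input}(x_1,\dots,x_l)$ first, $\mathtt{output}(x_1,\dots,x_l)$ last, others assignments $x_i:=y$, $x_i:=A[y_1,\dots,y_d]$, $A[y_1,\dots,y_d]:=y_0$ ($y_j$ variables, constants of $\sigma$, or special constants $0,max$), guesses $\mathtt{guess}\ x_i$, and while instructions with quantifier-free first-order tests over $\sigma\cup\{0,max\}$; $x_{l+1},\dots,x_k$ are free variables (never assigned or guessed). Semantics on $\mathcal A$ expanded by values of the free variables: $0,max$ arbitrary distinct elements (acceptance independent of the choice); input-output variables and arrays start at $0$; guesses nondeterministic; acceptance iff some computation reaches the output with all input-output variables equal to $max$. $\mathrm{NPSA}(2)$: schemes $\forall x_{i_1}\dots\forall x_{i_p}\rho$ with $\rho\in\mathrm{NPSA}(1)$ and the $x_{i_j}$ free variables of $\rho$, accepting iff $\rho$ accepts for all values of these (arrays initialised to $0$). $\mathrm{NPSA}(3)$: schemes built like those of $\mathrm{NPSA}(1)$ except that each while-test is a scheme of $\mathrm{NPSA}(2)$ whose free variables are variables of the outer scheme, evaluated on the input expanded by their current values with the test's arrays initialised to $0$, after which the outer computation resumes unchanged. $\mathrm{NPSB}(m)$ is the subclass of $\mathrm{NPSA}(m)$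 in which every assignment to an array element (at every level) has the form $A[\dots]:=max$. -}

module Defs where

open import Data.Nat using (ℕ; _≤_)
open import Data.Fin using (Fin)
open import Data.Fin.Properties using () renaming (_≟_ to _≟F_)
open import Data.Vec using (Vec; map)
open import Data.Vec.Properties using (≡-dec)
open import Data.List using (List; []; _∷_)
open import Data.Bool using (Bool; true; false; T; not; _∧_; _∨_)
open import Data.Sum using (_⊎_; inj₁; inj₂; [_,_])
open import Data.Product using (Σ; _×_; _,_)
open import Data.Empty using (⊥)
open import Relation.Nullary using (¬_; yes; no)
open import Relation.Nullary.Decidable using (⌊_⌋)
open import Relation.Binary.PropositionalEquality using (_≡_; _≢_; refl)

-- A structure of size n
-- has universe Fin n (every finite structure is isomorphic to one such).

record Sig : Set where
  field
    nRel   : ℕ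
    arity  : Fin nRel → ℕ
    nConst : ℕ
open Sig public

record Structure (σ : Sig) : Set where
  field
    size       : ℕ
    atLeastTwo : 2 ≤ size
    rel        : (r : Fin (nRel σ)) → Vec (Fin size) (arity σ r) → Bool
    const      : Fin (nConst σ) → Fin size
open Structure public

U : ∀ {σ} → Structure σ → Set
U A = Fin (size A)

Problem : Sig → Set₁
Problem σ = Structure σ → Set

-- Syntax of program schemes (NPSB: array writes only of the form A[..] := max)

module Syntax (σ : Sig) where

  data Term (X : Set) : Set where
    var   : X → Term X
    con   : Fin (nConst σ) → Term X
    zero' : Term X
    max'  : Term X

  data QF (X : Set) : Set where
    atom : (r : Fin (nRel σ)) → Vec (Term X) (arity σ r) → QF X
    _==_ : Term X → Term X → QF X
    ¬'_  : QF X → QF X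
    _∧'_ : QF X → QF X → QF X
    _∨'_ : QF X → QF X → QF X

  -- Instructions.  Tst: type of while-tests; Fin k: the input-output
  -- variables (assignable / guessable); V: the free variables (only read);
  -- na arrays, array a has arity ad a.
  data Instr (Tst : Set) (k : ℕ) (V : Set) (na : ℕ) (ad : Fin na → ℕ) : Set where
    assign   : Fin k → Term (Fin k ⊎ V) → Instr Tst k V na ad
    read     : Fin k → (a : Fin na) → Vec (Term (Fin k ⊎ V)) (ad a) → Instr Tst k V na ad
    writeMax : (a : Fin na) → Vec (Term (Fin k ⊎ V)) (ad a) → Instr Tst k V na ad
    guess    : Fin k → Instr Tst k V na ad
    while    : Tst → List (Instr Tst k V na ad) → Instr Tst k V na ad

  -- A scheme: input(x_1..x_k); body; output(x_1..x_k), with free variables V.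
  record Scheme (Test : ℕ → Set → Set) (V : Set) : Set where
    field
      k    : ℕ
      na   : ℕ
      ad   : Fin na → ℕ
      body : List (Instr (Test k V) k V na ad)

  Test1 : ℕ → Set → Set
  Test1 k V = QF (Fin k ⊎ V)

  Scheme1 : Set → Set
  Scheme1 V = Scheme Test1 V

  -- NPSB(2): ∀ y_1 … ∀ y_p ρ, with ρ ∈ NPSB(1) having free variables
  -- (Fin p ⊎ V); the Fin p ones are universally quantified.
  record Scheme2 (V : Set) : Set where
    field
      p     : ℕ
      inner : Scheme1 (Fin p ⊎ V)

  Test3 : ℕ → Set → Set
  Test3 k V = Scheme2 (Fin k ⊎ V)

  Scheme3 : Set → Set
  Scheme3 V = Scheme Test3 V

module Semantics {σ : Sig} (A : Structure σ) (z m : U A) where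
  open Syntax σ

  evalTerm : {X : Set} → (X → U A) → Term X → U A
  evalTerm e (var x) = e x
  evalTerm e (con c) = const A c
  evalTerm e zero'   = z
  evalTerm e max'    = m

  evalQF : {X : Set} → (X → U A) → QF X → Bool
  evalQF e (atom r ts) = rel A r (map (evalTerm e) ts)
  evalQF e (s == t)   = ⌊ evalTerm e s ≟F evalTerm e t ⌋
  evalQF e (¬' φ)     = not (evalQF e φ)
  evalQF e (φ ∧' ψ)   = evalQF e φ ∧ evalQF e ψ
  evalQF e (φ ∨' ψ)   = evalQF e φ ∨ evalQF e ψ

  module Exec {Tst : Set} {k : ℕ} {V : Set} {na : ℕ} {ad : Fin na → ℕ}
              (ν : V → U A) (evT : Tst → (Fin k ⊎ V → U A) → Set) where

    record State : Set where
      constructor st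
      field
        vars : Fin k → U A
        arr  : (a : Fin na) → Vec (U A) (ad a) → U A
    open State public

    env : State → Fin k ⊎ V → U A
    env s = [ vars s , ν ]

    setVar : State → Fin k → U A → State
    setVar s x u = st (λ y → f y (y ≟F x)) (arr s)
      where
        f : (y : Fin k) → _ → U A
        f y (yes _) = u
        f y (no _)  = vars s y

    updArr : ((a : Fin na) → Vec (U A) (ad a) → U A) →
             (a : Fin na) → Vec (U A) (ad a) → U A →
             (a : Fin na) → Vec (U A) (ad a) → U A
    updArr f a ix u a' ix' with a' ≟F a
    ... | no _ = f a' ix'
    ... | yes refl with ≡-dec _≟F_ ix' ix
    ...   | yes _ = u
    ...   | no _  = f a' ix'

    initial : State
    initial = st (λ _ → z) (λ _ _ → z)

    Ins : Set
    Ins = Instr Tst k V na ad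

    mutual
      data ExecI : Ins → State → State → Set where
        e-assign : ∀ {x t s} → ExecI (assign x t) s (setVar s x (evalTerm (env s) t))
        e-read   : ∀ {x a ts s} →
                   ExecI (read x a ts) s (setVar s x (arr s a (map (evalTerm (env s)) ts)))
        e-write  : ∀ {a ts s} →
                   ExecI (writeMax a ts) s
                         (st (vars s) (updArr (arr s) a (map (evalTerm (env s)) ts) m))
        e-guess  : ∀ {x s} (u : U A) → ExecI (guess x) s (setVar s x u)
        e-whileT : ∀ {t b s s' s''} → evT t (env s) → ExecL b s s' →
                   ExecI (while t b) s' s'' → ExecI (while t b) s s''
        e-whileF : ∀ {t b s} → ¬ evT t (env s) → ExecI (while t b) s s

      data ExecL : List Ins → State → State → Set where
        e-nil  : ∀ {s} → ExecL [] s s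
        e-cons : ∀ {i is s s' s''} → ExecI i s s' → ExecL is s' s'' → ExecL (i ∷ is) s s''

  AccG : {Test : ℕ → Set → Set} {V : Set} (ρ : Scheme Test V) →
         (Test (Scheme.k ρ) V → (Fin (Scheme.k ρ) ⊎ V → U A) → Set) →
         (V → U A) → Set
  AccG ρ evT ν =
    Σ State (λ s → ExecL (Scheme.body ρ) initial s × ((x : Fin (Scheme.k ρ)) → State.vars s x ≡ m))
    where open Exec {ad = Scheme.ad ρ} ν evT

  Acc1 : {V : Set} → Syntax.Scheme1 σ V → (V → U A) → Set
  Acc1 ρ ν = AccG ρ (λ φ e → T (evalQF e φ)) ν

  Acc2 : {V : Set} → Syntax.Scheme2 σ V → (V → U A) → Set
  Acc2 ρ ν = (w : Fin (Scheme2.p ρ) → U A) → Acc1 (Scheme2.inner ρ) [ w , ν ]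

  Acc3 : {V : Set} → Syntax.Scheme3 σ V → (V → U A) → Set
  Acc3 ρ ν = AccG ρ (λ t e → Acc2 t e) ν

-- A scheme decides P if, for every structure and every choice of
-- distinct 0, max, it accepts exactly when P holds (in particular its
-- acceptance is independent of the choice of 0, max).

noFree : {X : Set} → ⊥ → X
noFree ()

Decides : {σ : Sig} → ((A : Structure σ) → U A → U A → Set) → Problem σ → Set
Decides {σ} Acc P =
  (A : Structure σ) (z m : U A) → z ≢ m → (Acc A z m → P A) × (P A → Acc A z m)

InNPSB1 : (σ : Sig) → Problem σ → Set
InNPSB1 σ P = Σ (Syntax.Scheme1 σ ⊥) λ ρ → Decides (λ A z m → Semantics.Acc1 A z m ρ noFree) P

InNPSB2 : (σ : Sig) → Problem σ → Set
InNPSB2 σ P = Σ (Syntax.Scheme2 σ ⊥) λ ρ → Decides (λ A z m → Semantics.Acc2 A z m ρ noFree) P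

InNPSB3 : (σ : Sig) → Problem σ → Set
InNPSB3 σ P = Σ (Syntax.Scheme3 σ ⊥) λ ρ → Decides (λ A z m → Semantics.Acc3 A z m ρ noFree) P

{-# OPTIONS --safe #-}
-- An NPSB(1) computation on A is mirrored step by step along any embedding of A into B that
-- respects 0 and max: tests, guesses and array accesses take corresponding values, so acceptance
-- transfers from A to B. Hence NPSB(1) problems are closed under extensions, which "at most two
-- elements" (in NPSB(2): every y is 0 or max) is not. A while loop with test "x = 0 and ρ accepts"
-- and body x := max lets NPSB(3) evaluate an NPSB(2) scheme ρ, and "while ρ accepts do nothing"
-- evaluates its complement; as s-t reachability is in NPSB(1), non-reachability is in NPSB(3).
-- It is not in NPSB(2): on the path s = 0 → 1 → ⋯ → p + 2 = t any values of the p universally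
-- quantified variables miss some vertex j, and deleting j leaves a substructure without an s-t path,
-- on which the inner NPSB(1) scheme accepts; by the embedding property it also accepts on the path.
module Submission where

open import Defs
open import Data.Nat as ℕ using (ℕ; zero; suc; _+_; _≤_; _<_; z≤n; s≤s; _≤?_)
open import Data.Nat.Properties using (<⇒≱; ≰⇒>; ≤-refl; ≤∧≢⇒<; n≢0⇒n>0)
open import Data.Fin using (Fin; zero; suc; toℕ; fromℕ; punchIn; punchOut)
open import Data.Fin.Induction using (>-weakInduction)
open import Data.Fin.Properties
  using (_≟_; all?; any?; ¬∀⟶∃¬; injective⇒≤; suc-injective; toℕ-inject₁; toℕ-injective; toℕ-fromℕ;
         toℕ≤pred[n]; punchIn-injective; punchIn-punchOut; punchInᵢ≢i)
open import Data.Vec as Vec using (Vec; []; _∷_)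
open import Data.Vec.Properties
  using (map-id; map-cong; map-∘; ∷-injectiveˡ; ∷-injectiveʳ; ≡-dec)
open import Data.List using (List; []; _∷_)
open import Data.Bool using (Bool; true; false; T; not; _∧_; _∨_)
open import Data.Bool.Properties using (T-∨)
open import Data.Sum using (_⊎_; inj₁; inj₂; [_,_]; map₂) renaming (map to ⊎-map)
open import Data.Sum.Properties using () renaming (map-id to ⊎-map-id)
open import Data.Product using (Σ; _×_; _,_; proj₁; proj₂) renaming (map₂ to ×-map₂)
open import Data.Empty using (⊥; ⊥-elim)
open import Function using (id; _∘_; _⇔_; mk⇔; Equivalence)
open Equivalence using (to; from)
open import Function.Definitions using (Injective)
open import Relation.Nullary using (¬_; yes; no; does; contradiction)
open import Relation.Nullary.Decidable
  using (⌊_⌋; isYes≗does; does-⇔; toWitness; fromWitness; fromWitnessFalse)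
open import Relation.Binary.PropositionalEquality
  using (_≡_; _≢_; _≗_; refl; sym; trans; cong; cong₂; subst; module ≡-Reasoning)

Vec-map-injective : {X Y : Set} {f : X → Y} {n : ℕ} →
                    Injective _≡_ _≡_ f → Injective _≡_ _≡_ (Vec.map {n = n} f)
Vec-map-injective f-inj {[]}     {[]}     _  = refl
Vec-map-injective f-inj {x ∷ xs} {y ∷ ys} eq =
  cong₂ _∷_ (f-inj (∷-injectiveˡ eq)) (Vec-map-injective f-inj (∷-injectiveʳ eq))

⌊≟⌋-injective : {m n : ℕ} {f : Fin m → Fin n} → Injective _≡_ _≡_ f →
                ∀ a b → ⌊ f a ≟ f b ⌋ ≡ ⌊ a ≟ b ⌋
⌊≟⌋-injective {f = f} f-inj a b = begin
  ⌊ f a ≟ f b ⌋     ≡⟨ isYes≗does (f a ≟ f b) ⟩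
  does (f a ≟ f b)  ≡⟨ does-⇔ (mk⇔ f-inj (cong f)) (f a ≟ f b) (a ≟ b) ⟩
  does (a ≟ b)      ≡⟨ isYes≗does (a ≟ b) ⟨
  ⌊ a ≟ b ⌋         ∎
  where open ≡-Reasoning

¬T-not⇒T : ∀ b → ¬ T (not b) → T b
¬T-not⇒T true  _     = _
¬T-not⇒T false ¬T-not = ¬T-not _

T⇒¬T-not : ∀ {b} → T b → ¬ T (not b)
T⇒¬T-not {true} _ ()

T-≟-∨ : {n : ℕ} (y a b : Fin n) → T (⌊ y ≟ a ⌋ ∨ ⌊ y ≟ b ⌋) ⇔ (y ≡ a ⊎ y ≡ b)
T-≟-∨ y a b = mk⇔ (⊎-map toWitness toWitness ∘ to (T-∨ {⌊ y ≟ a ⌋} {⌊ y ≟ b ⌋}))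
                  (from (T-∨ {⌊ y ≟ a ⌋} {⌊ y ≟ b ⌋}) ∘ ⊎-map fromWitness fromWitness)

missed-value : {p n : ℕ} → p < n → (h : Fin p → Fin n) → Σ (Fin n) λ j → ∀ i → h i ≢ j
missed-value {p} {n} p<n h with all? (λ j → any? (λ i → h i ≟ j))
... | no ¬all-hit = let j , j-missed = ¬∀⟶∃¬ n _ (λ j → any? (λ i → h i ≟ j)) ¬all-hit
                    in j , λ i hi≡j → j-missed (i , hi≡j)
... | yes all-hit = contradiction (injective⇒≤ section-injective) (<⇒≱ p<n)
  where
    section-injective : Injective _≡_ _≡_ (λ j → proj₁ (all-hit j))
    section-injective {j} {j′} eq =
      trans (sym (proj₂ (all-hit j))) (trans (cong h eq) (proj₂ (all-hit j′)))

≤2⇔two-valued : {n : ℕ} {z m : Fin n} → z ≢ m → n ≤ 2 ⇔ (∀ y → y ≡ z ⊎ y ≡ m)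
≤2⇔two-valued {n} {z} {m} z≢m = mk⇔ (two-valued n z≢m) ≤2
  where
    two-valued : ∀ n {z m : Fin n} → z ≢ m → n ≤ 2 → ∀ y → y ≡ z ⊎ y ≡ m
    two-valued 1 {zero}     {zero}     z≢m _ _          = contradiction refl z≢m
    two-valued 2 {zero}     {zero}     z≢m _ _          = contradiction refl z≢m
    two-valued 2 {suc zero} {suc zero} z≢m _ _          = contradiction refl z≢m
    two-valued 2 {zero}     {suc zero} _   _ zero       = inj₁ refl
    two-valued 2 {zero}     {suc zero} _   _ (suc zero) = inj₂ refl
    two-valued 2 {suc zero} {zero}     _   _ zero       = inj₂ refl
    two-valued 2 {suc zero} {zero}     _   _ (suc zero) = inj₁ refl
    two-valued (suc (suc (suc _))) _ (s≤s (s≤s ()))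
    ≤2 : (∀ y → y ≡ z ⊎ y ≡ m) → n ≤ 2
    ≤2 two with n ≤? 2
    ... | yes n≤2 = n≤2
    ... | no n≰2
      with y , y-missed ← missed-value (≰⇒> n≰2) (λ { zero → z ; (suc zero) → m }) =
      ⊥-elim ([ y-missed zero ∘ sym , y-missed (suc zero) ∘ sym ] (two y))

Decides-⇔ : {σ : Sig} {Acc Acc′ : (A : Structure σ) → U A → U A → Set} {P : Problem σ} →
            (∀ A z m → z ≢ m → Acc′ A z m ⇔ Acc A z m) → Decides Acc P → Decides Acc′ P
Decides-⇔ Acc′⇔Acc dec A z m z≢m =
  proj₁ (dec A z m z≢m) ∘ to (Acc′⇔Acc A z m z≢m) ,
  from (Acc′⇔Acc A z m z≢m) ∘ proj₂ (dec A z m z≢m)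

Decides-¬ : {σ : Sig} {Acc : (A : Structure σ) → U A → U A → Set} {P : Problem σ} →
            Decides Acc P → Decides (λ A z m → ¬ Acc A z m) (λ A → ¬ P A)
Decides-¬ dec A z m z≢m =
  (λ ¬acc → ¬acc ∘ proj₂ (dec A z m z≢m)) , (λ ¬p → ¬p ∘ proj₁ (dec A z m z≢m))

-- Named because two absurd lambdas λ () are not definitionally equal.
noArrays : Fin 0 → ℕ
noArrays ()

module _ {σ : Sig} where
  open Syntax σ

  renameTerm : {X Y : Set} → (X → Y) → Term X → Term Y
  renameTerm g (var x) = var (g x)
  renameTerm g (con c) = con c
  renameTerm g zero'   = zero'
  renameTerm g max'    = max'

  renameQF : {X Y : Set} → (X → Y) → QF X → QF Y
  renameQF g (atom r ts) = atom r (Vec.map (renameTerm g) ts)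
  renameQF g (s == t)    = renameTerm g s == renameTerm g t
  renameQF g (¬' φ)      = ¬' renameQF g φ
  renameQF g (φ ∧' ψ)    = renameQF g φ ∧' renameQF g ψ
  renameQF g (φ ∨' ψ)    = renameQF g φ ∨' renameQF g ψ

  module _ {V W : Set} (r : V → W) {k na : ℕ} {ad : Fin na → ℕ} where
    mutual
      renameInstr : Instr (Test1 k V) k V na ad → Instr (Test1 k W) k W na ad
      renameInstr (assign x t)    = assign x (renameTerm (map₂ r) t)
      renameInstr (read x a ts)   = read x a (Vec.map (renameTerm (map₂ r)) ts)
      renameInstr (writeMax a ts) = writeMax a (Vec.map (renameTerm (map₂ r)) ts)
      renameInstr (guess x)       = guess x
      renameInstr (while φ b)     = while (renameQF (map₂ r) φ) (renameInstrs b)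

      renameInstrs : List (Instr (Test1 k V) k V na ad) → List (Instr (Test1 k W) k W na ad)
      renameInstrs []       = []
      renameInstrs (i ∷ is) = renameInstr i ∷ renameInstrs is

  renameScheme1 : {V W : Set} → (V → W) → Scheme1 V → Scheme1 W
  renameScheme1 r ρ = record
    { k = Scheme.k ρ ; na = Scheme.na ρ ; ad = Scheme.ad ρ ; body = renameInstrs r (Scheme.body ρ) }

  renameTerm-id : {X : Set} {g : X → X} → g ≗ id → (t : Term X) → renameTerm g t ≡ t
  renameTerm-id g≗id (var x) = cong var (g≗id x)
  renameTerm-id g≗id (con c) = refl
  renameTerm-id g≗id zero'   = refl
  renameTerm-id g≗id max'    = refl

  renameTerms-id : {X : Set} {g : X → X} {n : ℕ} → g ≗ id → (ts : Vec (Term X) n) →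
                   Vec.map (renameTerm g) ts ≡ ts
  renameTerms-id g≗id ts = trans (map-cong (renameTerm-id g≗id) ts) (map-id ts)

  renameQF-id : {X : Set} {g : X → X} → g ≗ id → (φ : QF X) → renameQF g φ ≡ φ
  renameQF-id g≗id (atom r ts) = cong (atom r) (renameTerms-id g≗id ts)
  renameQF-id g≗id (s == t)    = cong₂ _==_ (renameTerm-id g≗id s) (renameTerm-id g≗id t)
  renameQF-id g≗id (¬' φ)      = cong ¬'_ (renameQF-id g≗id φ)
  renameQF-id g≗id (φ ∧' ψ)    = cong₂ _∧'_ (renameQF-id g≗id φ) (renameQF-id g≗id ψ)
  renameQF-id g≗id (φ ∨' ψ)    = cong₂ _∨'_ (renameQF-id g≗id φ) (renameQF-id g≗id ψ)

  module _ {V : Set} {k na : ℕ} {ad : Fin na → ℕ} where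
    mutual
      renameInstr-id : (i : Instr (Test1 k V) k V na ad) → renameInstr id i ≡ i
      renameInstr-id (assign x t)    = cong (assign x) (renameTerm-id ⊎-map-id t)
      renameInstr-id (read x a ts)   = cong (read x a) (renameTerms-id ⊎-map-id ts)
      renameInstr-id (writeMax a ts) = cong (writeMax a) (renameTerms-id ⊎-map-id ts)
      renameInstr-id (guess x)       = refl
      renameInstr-id (while φ b)     = cong₂ while (renameQF-id ⊎-map-id φ) (renameInstrs-id b)

      renameInstrs-id : (is : List (Instr (Test1 k V) k V na ad)) → renameInstrs id is ≡ is
      renameInstrs-id []       = refl
      renameInstrs-id (i ∷ is) = cong₂ _∷_ (renameInstr-id i) (renameInstrs-id is)

  renameScheme1-id : {V : Set} (ρ : Scheme1 V) → renameScheme1 id ρ ≡ ρ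
  renameScheme1-id ρ =
    cong (λ b → record { k = Scheme.k ρ ; na = Scheme.na ρ ; ad = Scheme.ad ρ ; body = b })
         (renameInstrs-id (Scheme.body ρ))

record Embedding {σ : Sig} (A : Structure σ) (zA mA : U A) (B : Structure σ) (zB mB : U B) :
                 Set where
  field
    map        : U A → U B
    injective  : Injective _≡_ _≡_ map
    rel-pres   : ∀ r xs → rel B r (Vec.map map xs) ≡ rel A r xs
    const-pres : ∀ c → const B c ≡ map (const A c)
    zero-pres  : map zA ≡ zB
    max-pres   : map mA ≡ mB

id-embedding : {σ : Sig} (A : Structure σ) (z m : U A) → Embedding A z m A z m
id-embedding A z m = record
  { map = id ; injective = id ; rel-pres = λ r xs → cong (rel A r) (map-id xs)
  ; const-pres = λ _ → refl ; zero-pres = refl ; max-pres = refl }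

module Simulation {σ : Sig} {A B : Structure σ} {zA mA : U A} {zB mB : U B}
                  (e : Embedding A zA mA B zB mB) where
  open Syntax σ
  open Embedding e renaming (map to f)
  module SA = Semantics A zA mA
  module SB = Semantics B zB mB

  module _ {X YA YB : Set} (hA : X → YA) (hB : X → YB) (eA : YA → U A) (eB : YB → U B)
           (env-pres : ∀ x → eB (hB x) ≡ f (eA (hA x))) where
    evalTerm-rename : ∀ t → SB.evalTerm eB (renameTerm hB t) ≡ f (SA.evalTerm eA (renameTerm hA t))
    evalTerm-rename (var x) = env-pres x
    evalTerm-rename (con c) = const-pres c
    evalTerm-rename zero'   = sym zero-pres
    evalTerm-rename max'    = sym max-pres

    evalTerms-rename : ∀ {n} (ts : Vec (Term X) n) →
                       Vec.map (SB.evalTerm eB) (Vec.map (renameTerm hB) ts)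
                       ≡ Vec.map f (Vec.map (SA.evalTerm eA) (Vec.map (renameTerm hA) ts))
    evalTerms-rename ts = begin
      Vec.map (SB.evalTerm eB) (Vec.map (renameTerm hB) ts)        ≡⟨ map-∘ _ _ ts ⟨
      Vec.map (SB.evalTerm eB ∘ renameTerm hB) ts                  ≡⟨ map-cong evalTerm-rename ts ⟩
      Vec.map (f ∘ SA.evalTerm eA ∘ renameTerm hA) ts              ≡⟨ map-∘ f _ ts ⟩
      Vec.map f (Vec.map (SA.evalTerm eA ∘ renameTerm hA) ts)      ≡⟨ cong (Vec.map f) (map-∘ _ _ ts) ⟩
      Vec.map f (Vec.map (SA.evalTerm eA) (Vec.map (renameTerm hA) ts)) ∎
      where open ≡-Reasoning

    evalQF-rename : ∀ φ → SB.evalQF eB (renameQF hB φ) ≡ SA.evalQF eA (renameQF hA φ)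
    evalQF-rename (atom r ts) = trans (cong (rel B r) (evalTerms-rename ts)) (rel-pres r _)
    evalQF-rename (s == t)    =
      trans (cong₂ (λ a b → ⌊ a ≟ b ⌋) (evalTerm-rename s) (evalTerm-rename t))
            (⌊≟⌋-injective injective _ _)
    evalQF-rename (¬' φ)      = cong not (evalQF-rename φ)
    evalQF-rename (φ ∧' ψ)    = cong₂ _∧_ (evalQF-rename φ) (evalQF-rename ψ)
    evalQF-rename (φ ∨' ψ)    = cong₂ _∨_ (evalQF-rename φ) (evalQF-rename ψ)

  -- Two renamings of one scheme, so that this covers an embedding (rA = rB = id) as well as
  -- renaming free variables in either direction (f = id).
  module _ {V WA WB : Set} (rA : V → WA) (rB : V → WB) (νA : WA → U A) (νB : WB → U B)
           (ν-pres : ∀ v → νB (rB v) ≡ f (νA (rA v))) where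

    module Run {k na : ℕ} {ad : Fin na → ℕ} where
      module EA = SA.Exec {Test1 k WA} {k} {WA} {na} {ad} νA (λ φ e → T (SA.evalQF e φ))
      module EB = SB.Exec {Test1 k WB} {k} {WB} {na} {ad} νB (λ φ e → T (SB.evalQF e φ))

      record Related (sA : EA.State) (sB : EB.State) : Set where
        field
          vars-rel : ∀ x → EB.vars sB x ≡ f (EA.vars sA x)
          arr-rel  : ∀ a ix → EB.arr sB a (Vec.map f ix) ≡ f (EA.arr sA a ix)
      open Related

      initial-rel : Related EA.initial EB.initial
      initial-rel = record { vars-rel = λ _ → sym zero-pres ; arr-rel = λ _ _ → sym zero-pres }

      env-rel : ∀ {sA sB} → Related sA sB → ∀ x → EB.env sB (map₂ rB x) ≡ f (EA.env sA (map₂ rA x))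
      env-rel R (inj₁ x) = vars-rel R x
      env-rel R (inj₂ v) = ν-pres v

      module _ {sA sB} (R : Related sA sB) where
        evalTerm-rel : ∀ t → SB.evalTerm (EB.env sB) (renameTerm (map₂ rB) t)
                             ≡ f (SA.evalTerm (EA.env sA) (renameTerm (map₂ rA) t))
        evalTerm-rel = evalTerm-rename (map₂ rA) (map₂ rB) (EA.env sA) (EB.env sB) (env-rel R)

        evalTerms-rel :
          ∀ {n} (ts : Vec (Term (Fin k ⊎ V)) n) →
          Vec.map (SB.evalTerm (EB.env sB)) (Vec.map (renameTerm (map₂ rB)) ts)
          ≡ Vec.map f (Vec.map (SA.evalTerm (EA.env sA)) (Vec.map (renameTerm (map₂ rA)) ts))
        evalTerms-rel = evalTerms-rename (map₂ rA) (map₂ rB) (EA.env sA) (EB.env sB) (env-rel R)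

        evalQF-rel : ∀ φ → SB.evalQF (EB.env sB) (renameQF (map₂ rB) φ)
                           ≡ SA.evalQF (EA.env sA) (renameQF (map₂ rA) φ)
        evalQF-rel = evalQF-rename (map₂ rA) (map₂ rB) (EA.env sA) (EB.env sB) (env-rel R)

      setVar-rel : ∀ {sA sB} → Related sA sB → ∀ x {uA uB} → uB ≡ f uA →
                   Related (EA.setVar sA x uA) (EB.setVar sB x uB)
      setVar-rel R x u-rel .vars-rel y with y ≟ x
      ... | yes _ = u-rel
      ... | no _  = vars-rel R y
      setVar-rel R x u-rel .arr-rel = arr-rel R

      -- The index comparison in updArr gives the same answer on both sides because f is injective.
      updArr-rel : ∀ {FA FB} → (∀ a ix → FB a (Vec.map f ix) ≡ f (FA a ix)) →
                   ∀ a ix a′ ix′ → EB.updArr FB a (Vec.map f ix) mB a′ (Vec.map f ix′)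
                                   ≡ f (EA.updArr FA a ix mA a′ ix′)
      updArr-rel F-rel a ix a′ ix′ with a′ ≟ a
      ... | no _ = F-rel a′ ix′
      ... | yes refl with ≡-dec _≟_ ix′ ix | ≡-dec _≟_ (Vec.map f ix′) (Vec.map f ix)
      ...   | yes _    | yes _    = sym max-pres
      ...   | yes ix≡  | no fix≢  = contradiction (cong (Vec.map f) ix≡) fix≢
      ...   | no ix≢   | yes fix≡ = contradiction (Vec-map-injective injective fix≡) ix≢
      ...   | no _     | no _     = F-rel a′ ix′

      mutual
        simulate : ∀ i {sA sA′} → EA.ExecI (renameInstr rA i) sA sA′ → ∀ {sB} → Related sA sB →
                   Σ EB.State λ sB′ → EB.ExecI (renameInstr rB i) sB sB′ × Related sA′ sB′
        simulate (assign x t) EA.e-assign R =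
          _ , EB.e-assign , setVar-rel R x (evalTerm-rel R t)
        simulate (read x a ts) EA.e-read {sB} R =
          _ , EB.e-read , setVar-rel R x
                (trans (cong (EB.arr sB a) (evalTerms-rel R ts)) (arr-rel R a _))
        simulate (writeMax a ts) EA.e-write {sB} R =
          _ , EB.e-write , record
            { vars-rel = vars-rel R
            ; arr-rel  = λ a′ ix′ →
                trans (cong (λ ix → EB.updArr (EB.arr sB) a ix mB a′ (Vec.map f ix′))
                            (evalTerms-rel R ts))
                      (updArr-rel (arr-rel R) a _ a′ ix′) }
        simulate (guess x) (EA.e-guess u) R = _ , EB.e-guess (f u) , setVar-rel R x refl
        simulate (while φ b) (EA.e-whileT holds body rest) R
          with sB₁ , bodyB , R₁ ← simulateAll b body R
          with sB₂ , restB , R₂ ← simulate (while φ b) rest R₁ =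
          sB₂ , EB.e-whileT (subst T (sym (evalQF-rel R φ)) holds) bodyB restB , R₂
        simulate (while φ b) (EA.e-whileF fails) R =
          _ , EB.e-whileF (fails ∘ subst T (evalQF-rel R φ)) , R

        simulateAll : ∀ is {sA sA′} → EA.ExecL (renameInstrs rA is) sA sA′ → ∀ {sB} → Related sA sB →
                      Σ EB.State λ sB′ → EB.ExecL (renameInstrs rB is) sB sB′ × Related sA′ sB′
        simulateAll []       EA.e-nil R = _ , EB.e-nil , R
        simulateAll (i ∷ is) (EA.e-cons e es) R
          with sB₁ , e₁ , R₁ ← simulate i e R
          with sB₂ , e₂ , R₂ ← simulateAll is es R₁ = sB₂ , EB.e-cons e₁ e₂ , R₂

    acc1-transfer : (ρ : Scheme1 V) →
                    SA.Acc1 (renameScheme1 rA ρ) νA → SB.Acc1 (renameScheme1 rB ρ) νB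
    acc1-transfer ρ (sA , run , accepts)
      with sB , runB , R ← Run.simulateAll (Scheme.body ρ) run Run.initial-rel =
      sB , runB , λ x → trans (Run.Related.vars-rel R x) (trans (cong f (accepts x)) max-pres)

module _ {σ : Sig} where
  open Syntax σ
  open Simulation

  acc1-embed : {A B : Structure σ} {zA mA : U A} {zB mB : U B} (e : Embedding A zA mA B zB mB)
               {V : Set} {νA : V → U A} {νB : V → U B} → (∀ v → νB v ≡ Embedding.map e (νA v)) →
               (ρ : Scheme1 V) → Semantics.Acc1 A zA mA ρ νA → Semantics.Acc1 B zB mB ρ νB
  acc1-embed {A} {B} {zA} {mA} {zB} {mB} e {νA = νA} {νB} ν-pres ρ =
    subst (λ ρ′ → Semantics.Acc1 B zB mB ρ′ νB) (renameScheme1-id ρ)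
    ∘ acc1-transfer e id id νA νB ν-pres ρ
    ∘ subst (λ ρ′ → Semantics.Acc1 A zA mA ρ′ νA) (sym (renameScheme1-id ρ))

  module _ (A : Structure σ) (z m : U A) {V W : Set} (r : V → W) {ν : W → U A} {ν′ : V → U A}
           (ν∘r≗ν′ : ∀ v → ν (r v) ≡ ν′ v) (ρ : Scheme1 V) where
    open Semantics A z m

    acc1-rename⁺ : Acc1 ρ ν′ → Acc1 (renameScheme1 r ρ) ν
    acc1-rename⁺ = acc1-transfer (id-embedding A z m) id r ν′ ν ν∘r≗ν′ ρ
                   ∘ subst (λ ρ′ → Acc1 ρ′ ν′) (sym (renameScheme1-id ρ))

    acc1-rename⁻ : Acc1 (renameScheme1 r ρ) ν → Acc1 ρ ν′
    acc1-rename⁻ = subst (λ ρ′ → Acc1 ρ′ ν′) (renameScheme1-id ρ)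
                   ∘ acc1-transfer (id-embedding A z m) r id ν ν′ (sym ∘ ν∘r≗ν′) ρ

npsb1-upward-closed : {σ : Sig} {P : Problem σ} → InNPSB1 σ P →
                      {A B : Structure σ} {zA mA : U A} {zB mB : U B} → Embedding A zA mA B zB mB →
                      zA ≢ mA → zB ≢ mB → P A → P B
npsb1-upward-closed (ρ , dec) {A} {B} {zA} {mA} {zB} {mB} e zA≢mA zB≢mB =
  proj₁ (dec B zB mB zB≢mB) ∘ acc1-embed e (λ ()) ρ ∘ proj₂ (dec A zA mA zA≢mA)

module _ {σ : Sig} (A : Structure σ) (z m : U A) where
  open Syntax σ
  open Semantics A z m

  while-[]-inv : {Tst : Set} {k : ℕ} {V : Set} {na : ℕ} {ad : Fin na → ℕ}
                 {ν : V → U A} {evT : Tst → (Fin k ⊎ V → U A) → Set} →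
                 let open Exec {Tst} {k} {V} {na} {ad} ν evT in
                 ∀ {t s s′} → ExecI (while t []) s s′ → ¬ evT t (env s) × s′ ≡ s
  while-[]-inv (Exec.e-whileT _ Exec.e-nil rest) = while-[]-inv rest
  while-[]-inv (Exec.e-whileF fails)             = fails , refl

assert : {σ : Sig} {k : ℕ} {V : Set} {na : ℕ} {ad : Fin na → ℕ} →
         Syntax.QF σ (Fin k ⊎ V) → Syntax.Instr σ (Syntax.Test1 σ k V) k V na ad
assert ψ = Syntax.while (Syntax.¬' ψ) []

module _ {σ : Sig} (A : Structure σ) (z m : U A) {k : ℕ} {V : Set} {na : ℕ} {ad : Fin na → ℕ}
         (ν : V → U A) where
  open Syntax σ
  open Semantics A z m
  open Exec {Test1 k V} {k} {V} {na} {ad} ν (λ φ e → T (evalQF e φ))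

  assert-inv : ∀ {ψ s s′} → ExecI (assert ψ) s s′ → T (evalQF (env s) ψ) × s′ ≡ s
  assert-inv run with fails , refl ← while-[]-inv A z m run = ¬T-not⇒T _ fails , refl

  assert-pass : ∀ {ψ s} → T (evalQF (env s) ψ) → ExecI (assert ψ) s s
  assert-pass holds = e-whileF (T⇒¬T-not holds)

module _ {σ : Sig} where
  open Syntax σ

  scheme1→2 : {V : Set} → Scheme1 V → Scheme2 V
  scheme1→2 ρ = record { p = 0 ; inner = renameScheme1 inj₂ ρ }

  weaken2 : {V : Set} → Scheme2 ⊥ → Scheme2 V
  weaken2 ρ = record { p = Scheme2.p ρ ; inner = renameScheme1 (map₂ noFree) (Scheme2.inner ρ) }

  guardZero : {V : Set} → V → Scheme2 V → Scheme2 V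
  guardZero x ρ = record { p = Scheme2.p ρ ; inner = record
    { k = Scheme.k ρ₁ ; na = Scheme.na ρ₁ ; ad = Scheme.ad ρ₁
    ; body = assert (var (inj₂ (inj₂ x)) == zero') ∷ Scheme.body ρ₁ } }
    where ρ₁ = Scheme2.inner ρ

  module _ (A : Structure σ) (z m : U A) where
    open Semantics A z m

    acc2-scheme1→2 : {V : Set} {ν : V → U A} (ρ : Scheme1 V) → Acc2 (scheme1→2 ρ) ν ⇔ Acc1 ρ ν
    acc2-scheme1→2 ρ = mk⇔ (λ acc → acc1-rename⁻ A z m inj₂ (λ _ → refl) ρ (acc λ ()))
                           (λ acc _ → acc1-rename⁺ A z m inj₂ (λ _ → refl) ρ acc)

    acc2-weaken2 : {V : Set} {ν : V → U A} (ρ : Scheme2 ⊥) → Acc2 (weaken2 ρ) ν ⇔ Acc2 ρ noFree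
    acc2-weaken2 {ν = ν} ρ =
      mk⇔ (λ acc w → acc1-rename⁻ A z m (map₂ noFree) (agree w) (Scheme2.inner ρ) (acc w))
          (λ acc w → acc1-rename⁺ A z m (map₂ noFree) (agree w) (Scheme2.inner ρ) (acc w))
      where
        agree : (w : Fin (Scheme2.p ρ) → U A) → ∀ y → [ w , ν ] (map₂ noFree y) ≡ [ w , noFree ] y
        agree w (inj₁ _) = refl

    acc2-guardZero : {V : Set} {ν : V → U A} (x : V) (ρ : Scheme2 V) →
                     Acc2 (guardZero x ρ) ν ⇔ (ν x ≡ z × Acc2 ρ ν)
    acc2-guardZero {ν = ν} x ρ = mk⇔
      (λ acc → toWitness (proj₁ (unguard (acc λ _ → z))) , λ w → proj₂ (unguard (acc w)))
      (λ { (x≡z , acc) w → let s , run , accepts = acc w in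
                           s , Exec.e-cons (assert-pass A z m _ (fromWitness x≡z)) run , accepts })
      where
        unguard : ∀ {w} → Acc1 (Scheme2.inner (guardZero x ρ)) [ w , ν ] →
                  T ⌊ ν x ≟ z ⌋ × Acc1 (Scheme2.inner ρ) [ w , ν ]
        unguard (s , Exec.e-cons guard run , accepts)
          with holds , refl ← assert-inv A z m _ guard = holds , s , run , accepts

  scheme2→3 : Scheme2 ⊥ → Scheme3 ⊥
  scheme2→3 ρ = record { k = 1 ; na = 0 ; ad = noArrays
    ; body = while (guardZero (inj₁ zero) (weaken2 ρ)) (assign zero max' ∷ []) ∷ [] }

  complement2→3 : Scheme2 ⊥ → Scheme3 ⊥
  complement2→3 ρ = record { k = 1 ; na = 0 ; ad = noArrays
    ; body = while (weaken2 ρ) [] ∷ assign zero max' ∷ [] }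

  module _ (A : Structure σ) (z m : U A) (ρ : Scheme2 ⊥) where
    open Semantics A z m

    -- When ρ accepts, the loop runs exactly once: its test requires x = 0 and its body sets x := max.
    acc3-scheme2→3 : z ≢ m → Acc3 (scheme2→3 ρ) noFree ⇔ Acc2 ρ noFree
    acc3-scheme2→3 z≢m = mk⇔
      (λ { (_ , Exec.e-cons (Exec.e-whileT holds _ _) Exec.e-nil , _) → proj₂ (test⇒ holds)
         ; (_ , Exec.e-cons (Exec.e-whileF _) Exec.e-nil , accepts) → contradiction (accepts zero) z≢m })
      (λ acc → _ , Exec.e-cons (Exec.e-whileT (test⇐ (refl , acc))
                                              (Exec.e-cons Exec.e-assign Exec.e-nil)
                                              (Exec.e-whileF (z≢m ∘ sym ∘ proj₁ ∘ test⇒)))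
                               Exec.e-nil
                 , λ { zero → refl })
      where
        test⇒ : ∀ {ν} → Acc2 (guardZero (inj₁ zero) (weaken2 ρ)) ν →
                ν (inj₁ zero) ≡ z × Acc2 ρ noFree
        test⇒ = ×-map₂ (to (acc2-weaken2 A z m ρ)) ∘ to (acc2-guardZero A z m (inj₁ zero) (weaken2 ρ))

        test⇐ : ∀ {ν} → ν (inj₁ zero) ≡ z × Acc2 ρ noFree →
                Acc2 (guardZero (inj₁ zero) (weaken2 ρ)) ν
        test⇐ = from (acc2-guardZero A z m (inj₁ zero) (weaken2 ρ))
                ∘ ×-map₂ (from (acc2-weaken2 A z m ρ))

    acc3-complement2→3 : Acc3 (complement2→3 ρ) noFree ⇔ (¬ Acc2 ρ noFree)
    acc3-complement2→3 = mk⇔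
      (λ { (_ , Exec.e-cons loop _ , _) →
           proj₁ (while-[]-inv A z m loop) ∘ from (acc2-weaken2 A z m ρ) })
      (λ ¬acc → _ , Exec.e-cons (Exec.e-whileF (¬acc ∘ to (acc2-weaken2 A z m ρ)))
                                (Exec.e-cons Exec.e-assign Exec.e-nil)
                  , λ { zero → refl })

npsb1⊆npsb2 : (σ : Sig) (P : Problem σ) → InNPSB1 σ P → InNPSB2 σ P
npsb1⊆npsb2 σ P (ρ , dec) = scheme1→2 ρ , Decides-⇔ (λ A z m _ → acc2-scheme1→2 A z m ρ) dec

npsb2⊆npsb3 : (σ : Sig) (P : Problem σ) → InNPSB2 σ P → InNPSB3 σ P
npsb2⊆npsb3 σ P (ρ , dec) = scheme2→3 ρ , Decides-⇔ (λ A z m z≢m → acc3-scheme2→3 A z m ρ z≢m) dec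

npsb2-complement⊆npsb3 : (σ : Sig) (P : Problem σ) → InNPSB2 σ P → InNPSB3 σ (λ A → ¬ P A)
npsb2-complement⊆npsb3 σ P (ρ , dec) =
  complement2→3 ρ , Decides-⇔ (λ A z m _ → acc3-complement2→3 A z m ρ) (Decides-¬ dec)

σ∅ : Sig
σ∅ = record { nRel = 0 ; arity = λ () ; nConst = 0 }

AtMostTwo : Problem σ∅
AtMostTwo A = size A ≤ 2

module _ where
  open Syntax σ∅

  atMostTwo-scheme : Scheme2 ⊥
  atMostTwo-scheme = record { p = 1 ; inner = record { k = 1 ; na = 0 ; ad = noArrays
    ; body = assert ((y == zero') ∨' (y == max')) ∷ assign zero max' ∷ [] } }
    where
      y : Term (Fin 1 ⊎ (Fin 1 ⊎ ⊥))
      y = var (inj₂ (inj₁ zero))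

  acc2-atMostTwo : (A : Structure σ∅) (z m : U A) →
                   Semantics.Acc2 A z m atMostTwo-scheme noFree ⇔ (∀ y → y ≡ z ⊎ y ≡ m)
  acc2-atMostTwo A z m = mk⇔
    (λ acc y → to (T-≟-∨ y z m) (checked (acc λ _ → y)))
    (λ two-valued w →
       _ , Exec.e-cons (assert-pass A z m _ (from (T-≟-∨ (w zero) z m) (two-valued (w zero))))
                       (Exec.e-cons Exec.e-assign Exec.e-nil)
         , λ { zero → refl })
    where
      open Semantics A z m

      checked : ∀ {w} → Acc1 (Scheme2.inner atMostTwo-scheme) [ w , noFree ] →
                T (⌊ w zero ≟ z ⌋ ∨ ⌊ w zero ≟ m ⌋)
      checked (_ , Exec.e-cons check _ , _) = proj₁ (assert-inv A z m _ check)

atMostTwo∈npsb2 : InNPSB2 σ∅ AtMostTwo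
atMostTwo∈npsb2 = atMostTwo-scheme , λ A z m z≢m →
  from (≤2⇔two-valued z≢m) ∘ to (acc2-atMostTwo A z m) ,
  from (acc2-atMostTwo A z m) ∘ to (≤2⇔two-valued z≢m)

discrete : ℕ → Structure σ∅
discrete n = record { size = 2 + n ; atLeastTwo = s≤s (s≤s z≤n) ; rel = λ () ; const = λ () }

atMostTwo∉npsb1 : ¬ InNPSB1 σ∅ AtMostTwo
atMostTwo∉npsb1 npsb1 = 3≰2 (npsb1-upward-closed npsb1 suc-embedding (λ ()) (λ ()) (s≤s (s≤s z≤n)))
  where
    suc-embedding : Embedding (discrete 0) zero (suc zero) (discrete 1) (suc zero) (suc (suc zero))
    suc-embedding = record { map = suc ; injective = suc-injective ; rel-pres = λ ()
                           ; const-pres = λ () ; zero-pres = refl ; max-pres = refl }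

    3≰2 : ¬ 3 ≤ 2
    3≰2 (s≤s (s≤s ()))

σGraph : Sig
σGraph = record { nRel = 1 ; arity = λ _ → 2 ; nConst = 2 }

data Reach (A : Structure σGraph) : U A → U A → Set where
  here : ∀ {a} → Reach A a a
  step : ∀ {a b c} → T (rel A zero (a ∷ b ∷ [])) → Reach A b c → Reach A a c

Reachable : Problem σGraph
Reachable A = Reach A (const A zero) (const A (suc zero))

module _ where
  open Syntax σGraph

  current next : Fin 2
  current = zero
  next    = suc zero

  walk : Instr (Test1 2 ⊥) 2 ⊥ 0 noArrays
  walk = while (¬' (var (inj₁ current) == con (suc zero)))
    ( guess next
    ∷ assert (atom zero (var (inj₁ current) ∷ var (inj₁ next) ∷ []))
    ∷ assign current (var (inj₁ next))
    ∷ [])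

  reachability-scheme : Scheme1 ⊥
  reachability-scheme = record { k = 2 ; na = 0 ; ad = noArrays
    ; body = assign current (con zero) ∷ walk ∷ assign current max' ∷ assign next max' ∷ [] }

  module _ (A : Structure σGraph) (z m : U A) where
    open Semantics A z m
    open Exec {Test1 2 ⊥} {2} {⊥} {0} {noArrays} noFree (λ φ e → T (evalQF e φ))

    target : U A
    target = const A (suc zero)

    walk-sound : ∀ {s s′} → ExecI walk s s′ → Reach A (vars s current) target
    walk-sound (e-whileF at-target) =
      subst (λ a → Reach A a target) (sym (toWitness (¬T-not⇒T _ at-target))) here
    walk-sound (e-whileT _ (e-cons (e-guess _) (e-cons edge (e-cons e-assign e-nil))) rest)
      with holds , refl ← assert-inv A z m noFree edge = step holds (walk-sound rest)

    walk-complete : ∀ {a} → Reach A a target → ∀ s → vars s current ≡ a → Σ State (ExecI walk s)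
    walk-complete here s at-target =
      _ , e-whileF (T⇒¬T-not (fromWitness {a? = vars s current ≟ target} at-target))
    walk-complete (step {b = b} edge rest) s refl with vars s current ≟ target
    ... | yes at-target = _ , e-whileF (T⇒¬T-not (fromWitness {a? = vars s current ≟ target} at-target))
    ... | no ¬at-target
      with s′ , run ← walk-complete rest (setVar (setVar s next b) current b) refl =
      s′ , e-whileT (fromWitnessFalse {a? = vars s current ≟ target} ¬at-target)
                    (e-cons (e-guess b) (e-cons (assert-pass A z m noFree edge) (e-cons e-assign e-nil)))
                    run

    acc1-reachability : Acc1 reachability-scheme noFree ⇔ Reachable A
    acc1-reachability = mk⇔
      (λ { (_ , e-cons e-assign (e-cons run _) , _) → walk-sound run })
      (λ reach → let _ , run = walk-complete reach (setVar initial current (const A zero)) refl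
                 in _ , e-cons e-assign (e-cons run (e-cons e-assign (e-cons e-assign e-nil)))
                      , λ { zero → refl ; (suc zero) → refl })

reachability∈npsb1 : InNPSB1 σGraph Reachable
reachability∈npsb1 = reachability-scheme , λ A z m _ →
  to (acc1-reachability A z m) , from (acc1-reachability A z m)

successor : {n : ℕ} → Fin 1 → Vec (Fin n) 2 → Bool
successor _ (a ∷ b ∷ []) = ⌊ suc (toℕ a) ℕ.≟ toℕ b ⌋

path : ℕ → Structure σGraph
path n = record { size = 2 + n ; atLeastTwo = s≤s (s≤s z≤n) ; rel = successor
                ; const = λ { zero → zero ; (suc zero) → fromℕ (suc n) } }

reachable-path : ∀ n → Reachable (path n)
reachable-path n = >-weakInduction (λ a → Reach (path n) a (fromℕ (suc n))) here
  (λ a → step (fromWitness (cong suc (toℕ-inject₁ a)))) zero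

module PuncturedPath {p : ℕ} (w : Fin p → Fin (3 + p)) where
  avoided : Fin (2 + p) → Fin (3 + p)
  avoided zero          = zero
  avoided (suc zero)    = fromℕ (2 + p)
  avoided (suc (suc i)) = w i

  j : Fin (3 + p)
  j = proj₁ (missed-value ≤-refl avoided)

  j-missed : ∀ i → avoided i ≢ j
  j-missed = proj₂ (missed-value ≤-refl avoided)

  preimage : Fin (2 + p) → Fin (2 + p)
  preimage i = punchOut (j-missed i ∘ sym)

  punchIn-preimage : ∀ i → punchIn j (preimage i) ≡ avoided i
  punchIn-preimage i = punchIn-punchOut _

  w′ : Fin p → Fin (2 + p)
  w′ i = preimage (suc (suc i))

  punchIn-w′ : ∀ i → punchIn j (w′ i) ≡ w i
  punchIn-w′ i = punchIn-preimage (suc (suc i))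

  punctured : Structure σGraph
  punctured = record { size = 2 + p ; atLeastTwo = s≤s (s≤s z≤n)
                     ; rel = λ r → successor r ∘ Vec.map (punchIn j)
                     ; const = λ { zero → preimage zero ; (suc zero) → preimage (suc zero) } }

  embedding : Embedding punctured (preimage zero) (preimage (suc zero))
                        (path (suc p)) zero (fromℕ (2 + p))
  embedding = record
    { map = punchIn j ; injective = punchIn-injective j _ _ ; rel-pres = λ _ _ → refl
    ; const-pres = λ { zero → sym (punchIn-preimage zero)
                     ; (suc zero) → sym (punchIn-preimage (suc zero)) }
    ; zero-pres = punchIn-preimage zero ; max-pres = punchIn-preimage (suc zero) }

  source≢target : preimage zero ≢ preimage (suc zero)
  source≢target eq
    with () ← trans (sym (punchIn-preimage zero))
                    (trans (cong (punchIn j) eq) (punchIn-preimage (suc zero)))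

  -- Every edge raises the index by one, so a walk starting below j can never step over it.
  below-j : ∀ {a b} → Reach punctured a b →
            toℕ (punchIn j a) < toℕ j → toℕ (punchIn j b) < toℕ j
  below-j here a<j = a<j
  below-j (step {b = b} edge rest) a<j =
    below-j rest (≤∧≢⇒< (subst (_≤ toℕ j) (toWitness edge) a<j) (punchInᵢ≢i j b ∘ toℕ-injective))

  unreachable : ¬ Reachable punctured
  unreachable reach = <⇒≱ (below-j reach source<j) target≥j
    where
      source<j : toℕ (punchIn j (preimage zero)) < toℕ j
      source<j = subst (λ a → toℕ a < toℕ j) (sym (punchIn-preimage zero))
                       (n≢0⇒n>0 (j-missed zero ∘ sym ∘ toℕ-injective))
      target≥j : toℕ j ≤ toℕ (punchIn j (preimage (suc zero)))
      target≥j = subst (λ a → toℕ j ≤ toℕ a) (sym (punchIn-preimage (suc zero)))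
                       (subst (toℕ j ≤_) (sym (toℕ-fromℕ (2 + p))) (toℕ≤pred[n] j))

unreachability∉npsb2 : ¬ InNPSB2 σGraph (λ A → ¬ Reachable A)
unreachability∉npsb2 (ρ , dec) =
  proj₁ (dec (path (suc p)) zero (fromℕ (2 + p)) (λ ())) acc2-path (reachable-path (suc p))
  where
    p : ℕ
    p = Syntax.Scheme2.p ρ

    acc2-path : Semantics.Acc2 (path (suc p)) zero (fromℕ (2 + p)) ρ noFree
    acc2-path w = acc1-embed embedding agree (Syntax.Scheme2.inner ρ)
                    (proj₂ (dec punctured _ _ source≢target) unreachable w′)
      where
        open PuncturedPath w
        agree : ∀ v → [ w , noFree ] v ≡ punchIn j ([ w′ , noFree ] v)
        agree (inj₁ i) = sym (punchIn-w′ i)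

proposition18 :
    ((σ : Sig) (P : Problem σ) → InNPSB1 σ P → InNPSB2 σ P)
    × (Σ Sig λ σ → Σ (Problem σ) λ P → InNPSB2 σ P × ¬ InNPSB1 σ P)
    × ((σ : Sig) (P : Problem σ) → InNPSB2 σ P → InNPSB3 σ P)
    × (Σ Sig λ σ → Σ (Problem σ) λ P → InNPSB3 σ P × ¬ InNPSB2 σ P)
proposition18 =
  npsb1⊆npsb2 ,
  (σ∅ , AtMostTwo , atMostTwo∈npsb2 , atMostTwo∉npsb1) ,
  npsb2⊆npsb3 ,
  (σGraph , (λ A → ¬ Reachable A) ,
   npsb2-complement⊆npsb3 σGraph Reachable (npsb1⊆npsb2 σGraph Reachable reachability∈npsb1) ,
   unreachability∉npsb2)
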